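{- Let $k,y,X,H\geqslant1$ be integers. Let $B_k(X,H;y)$ be the set of integer tuples $(x,t_1,\dots,t_k,h_1,\dots,h_k)\in[X]\times[H]^k\times[-H,H]^k$ with $y\mid(x+t_1)(x+t_2)\cdots(x+t_k)h_1h_2\cdots h_k$ and $h_1h_2\cdots h_k\neq0$. Then \[\#B_k(X,H;y)\leqslant O(H)^{2k}\cdot\tau_2(y)\tau_k(y)^2\cdot O(1+X/\operatorname{rad}_k(y)).\]
   Context: $[N]=\{1,\dots,N\}$. $\tau_k(n)$ is the number of tuples $(d_1,\dots,d_k)$ of positive integers with $d_1\cdots d_k=n$. $\operatorname{rad}_k$ is the multiplicative function $\operatorname{rad}_k(n)=\min_{n_1\cdots n_k=n}[n_1,\dots,n_k]$, the minimum over factorizations into $k$ positive integers of their least common multiple. -}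

module Defs where

open import Data.Nat as ℕ using (ℕ; zero; suc; _+_; _*_; _⊓_)
open import Data.Nat.LCM using (lcm)
open import Data.Integer as ℤ using (ℤ; +_)
open import Data.Integer.Divisibility as ℤD using ()
open import Data.Nat.Divisibility using (_∣?_)
open import Data.List as L using (List; []; _∷_; [_]; map; concatMap; upTo; length; filter; foldr)
open import Data.Vec as V using (Vec; []; _∷_)
open import Data.Product using (_×_; _,_; proj₁; proj₂)
open import Relation.Nullary using (¬_; Dec)
open import Relation.Nullary.Decidable using (_×-dec_; ¬?)
open import Relation.Binary.PropositionalEquality using (_≡_)

allVecs : {A : Set} → (k : ℕ) → List A → List (Vec A k)
allVecs zero    xs = [ [] ]
allVecs (suc k) xs = concatMap (λ a → map (a ∷_) (allVecs k xs)) xs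

range1 : ℕ → List ℕ
range1 N = map suc (upTo N)

rangeSym : ℕ → List ℤ
rangeSym H = map (λ i → (+ i) ℤ.- (+ H)) (upTo (suc (2 * H)))

prodℕ : {k : ℕ} → Vec ℕ k → ℕ
prodℕ = V.foldr _ _*_ 1

prodℤ : {k : ℕ} → Vec ℤ k → ℤ
prodℤ = V.foldr _ ℤ._*_ (+ 1)

lcmVec : {k : ℕ} → Vec ℕ k → ℕ
lcmVec = V.foldr _ lcm 1

-- k-tuples of positive integers with product n (for n ≥ 1 all entries lie in [n])
factorizations : (k n : ℕ) → List (Vec ℕ k)
factorizations k n = filter (λ v → prodℕ v ℕ.≟ n) (allVecs k (range1 n))

τ : ℕ → ℕ → ℕ
τ k n = length (factorizations k n)

-- rad_k(n) = min over factorizations n = n₁⋯n_k of lcm[n₁,…,n_k].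
-- The fold starts at n, which is itself attained by (n,1,…,1) when k ≥ 1, n ≥ 1,
-- so this is exactly the minimum in that range.
rad : ℕ → ℕ → ℕ
rad k n = foldr (λ v m → lcmVec v ⊓ m) n (factorizations k n)

Tuple : ℕ → Set
Tuple k = ℕ × Vec ℕ k × Vec ℤ k

allTuples : (k X H : ℕ) → List (Tuple k)
allTuples k X H =
  concatMap (λ x → concatMap (λ t → map (λ h → x , t , h) (allVecs k (rangeSym H)))
                             (allVecs k (range1 H)))
            (range1 X)

InB : (k y : ℕ) → Tuple k → Set
InB k y (x , t , h) =
  ((+ y) ℤD.∣ ((+ prodℕ (V.map (λ ti → x + ti) t)) ℤ.* prodℤ h)) × ¬ (prodℤ h ≡ + 0)

InB? : (k y : ℕ) → (p : Tuple k) → Dec (InB k y p)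
InB? k y (x , t , h) =
  (y ∣? ℤ.∣ (+ prodℕ (V.map (λ ti → x + ti) t)) ℤ.* prodℤ h ∣) ×-dec ¬? (prodℤ h ℤ.≟ + 0)

cardB : (k X H y : ℕ) → ℕ
cardB k X H y = length (filter (InB? k y) (allTuples k X H))

-- If y divides (x+t₁)⋯(x+tₖ)·h₁⋯hₖ, then y = A B with A ∣ ∏(x+tᵢ) and B ∣ ∏hᵢ, and these split
-- further as A = a₁⋯aₖ and B = b₁⋯bₖ with aᵢ ∣ x+tᵢ and bᵢ ∣ hᵢ; there are at most τ₂(y)τₖ(y)² such
-- pairs (a, b). For fixed (a, b) and t the admissible x are lcm(a) apart, so there are at most
-- 1 + X/lcm(a) of them, and each hᵢ ∈ [-H,H]∖{0} has at most 2H/bᵢ choices. The loss 1/B is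
-- recovered from rad_k(y) ≤ lcm(a₁B, a₂, …, aₖ) ≤ lcm(a)·B.

module Submission where

open import Defs
open import Data.Empty using (⊥-elim)
open import Data.Integer as ℤ using (ℤ)
import Data.Integer.Properties as ℤ
import Data.Integer.Divisibility.Signed as ℤ
open import Data.Integer.Solver using () renaming (module +-*-Solver to ℤ-Solver)
open import Data.List as List using (List; []; _∷_; [_]; _++_; map; concatMap; upTo; length; filter; cartesianProduct)
import Data.List.Properties as List
open import Data.List.Membership.Propositional using (_∈_)
open import Data.List.Membership.Propositional.Properties
  using (∈-map⁺; ∈-concatMap⁺; ∈-filter⁺; ∈-filter⁻; ∈-cartesianProduct⁺; ∈-upTo⁺)
open import Data.List.Relation.Unary.Any as Any using (here; there)
open import Data.Nat
open import Data.Nat.Properties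
open import Data.Nat.Divisibility
open import Data.Nat.DivMod using (_/_; m/n*n≡m; m*n/n≡m)
open import Data.Nat.GCD using (gcd; gcd[m,n]∣m; gcd[m,n]∣n; gcd[m,n]≢0)
open import Data.Nat.LCM using (lcm; lcm-least; m∣lcm[m,n]; n∣lcm[m,n])
open import Data.Nat.Coprimality using (coprime-divisor; coprime-/gcd)
open import Data.Nat.Solver using (module +-*-Solver)
open import Data.Product using (Σ; ∃; ∃₂; _×_; _,_; proj₂)
open import Data.Sum using (_⊎_; inj₁; inj₂)
open import Function using (_∘_)
open import Data.Vec as Vec using (Vec; []; _∷_)
open import Data.Vec.Relation.Binary.Pointwise.Inductive as Pointwise using (Pointwise; []; _∷_)
open import Data.Vec.Relation.Unary.All as All using (All; []; _∷_)
open import Relation.Nullary using (Dec; yes; no; ¬_)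
open import Relation.Nullary.Decidable using (_×-dec_; ¬?)
open import Relation.Unary using (Decidable)
open import Relation.Binary.PropositionalEquality hiding ([_])

-- Finite sums and indicators

∑ : {A : Set} → List A → (A → ℕ) → ℕ
∑ []       f = 0
∑ (x ∷ xs) f = f x + ∑ xs f

infix 5 ∑
syntax ∑ xs (λ x → e) = ∑[ x ∈ xs ] e

𝟙 : {P : Set} → Dec P → ℕ
𝟙 (yes _) = 1
𝟙 (no _)  = 0

𝟙-yes : {P : Set} (P? : Dec P) → P → 𝟙 P? ≡ 1
𝟙-yes (yes _) _ = refl
𝟙-yes (no ¬p) p = ⊥-elim (¬p p)

𝟙≤ : {P : Set} (P? : Dec P) {n : ℕ} → (P → 1 ≤ n) → 𝟙 P? ≤ n
𝟙≤ (yes p) 1≤n = 1≤n p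
𝟙≤ (no _)  _   = z≤n

𝟙-mono : {P Q : Set} → (Q → P) → (Q? : Dec Q) (P? : Dec P) → 𝟙 Q? ≤ 𝟙 P?
𝟙-mono Q⇒P (yes q) (yes _) = ≤-refl
𝟙-mono Q⇒P (yes q) (no ¬p) = ⊥-elim (¬p (Q⇒P q))
𝟙-mono Q⇒P (no _)  _       = z≤n

𝟙-mono-< : {P Q : Set} → ¬ Q → P → (Q? : Dec Q) (P? : Dec P) → 𝟙 Q? < 𝟙 P?
𝟙-mono-< ¬q p (yes q) _       = ⊥-elim (¬q q)
𝟙-mono-< ¬q p (no _)  (yes _) = s≤s z≤n
𝟙-mono-< ¬q p (no _)  (no ¬p) = ⊥-elim (¬p p)

module _ {A : Set} where

  ∑-++ : (f : A → ℕ) (xs ys : List A) → ∑ (xs ++ ys) f ≡ ∑ xs f + ∑ ys f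
  ∑-++ f []       ys = refl
  ∑-++ f (x ∷ xs) ys = trans (cong (f x +_) (∑-++ f xs ys)) (sym (+-assoc (f x) _ _))

  ∑-cong : {f g : A → ℕ} (xs : List A) → (∀ x → f x ≡ g x) → ∑ xs f ≡ ∑ xs g
  ∑-cong []       f≗g = refl
  ∑-cong (x ∷ xs) f≗g = cong₂ _+_ (f≗g x) (∑-cong xs f≗g)

  ∑-mono-≤ : {f g : A → ℕ} (xs : List A) → (∀ x → f x ≤ g x) → ∑ xs f ≤ ∑ xs g
  ∑-mono-≤ []       f≤g = z≤n
  ∑-mono-≤ (x ∷ xs) f≤g = +-mono-≤ (f≤g x) (∑-mono-≤ xs f≤g)

  ∑-*ˡ : (c : ℕ) (f : A → ℕ) (xs : List A) → ∑[ x ∈ xs ] c * f x ≡ c * ∑ xs f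
  ∑-*ˡ c f []       = sym (*-zeroʳ c)
  ∑-*ˡ c f (x ∷ xs) = trans (cong (c * f x +_) (∑-*ˡ c f xs)) (sym (*-distribˡ-+ c (f x) _))

  ∑-*ʳ : (c : ℕ) (f : A → ℕ) (xs : List A) → ∑[ x ∈ xs ] f x * c ≡ ∑ xs f * c
  ∑-*ʳ c f []       = refl
  ∑-*ʳ c f (x ∷ xs) = trans (cong (f x * c +_) (∑-*ʳ c f xs)) (sym (*-distribʳ-+ c (f x) _))

  ∑-zero : (xs : List A) → ∑[ x ∈ xs ] 0 ≡ 0
  ∑-zero []       = refl
  ∑-zero (x ∷ xs) = ∑-zero xs

  ∑-+ : (f g : A → ℕ) (xs : List A) → ∑[ x ∈ xs ] (f x + g x) ≡ ∑ xs f + ∑ xs g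
  ∑-+ f g []       = refl
  ∑-+ f g (x ∷ xs) = begin
    f x + g x + (∑[ x ∈ xs ] (f x + g x))  ≡⟨ cong (f x + g x +_) (∑-+ f g xs) ⟩
    f x + g x + (∑ xs f + ∑ xs g)          ≡⟨ solve 4 (λ a b c d → a :+ b :+ (c :+ d) := a :+ c :+ (b :+ d))
                                                     refl (f x) (g x) (∑ xs f) (∑ xs g) ⟩
    f x + ∑ xs f + (g x + ∑ xs g)          ∎
    where open ≡-Reasoning; open +-*-Solver

  length≡∑1 : (xs : List A) → length xs ≡ ∑ xs (λ _ → 1)
  length≡∑1 []       = refl
  length≡∑1 (x ∷ xs) = cong suc (length≡∑1 xs)

  ∑-const : (c : ℕ) (xs : List A) → ∑[ x ∈ xs ] c ≡ length xs * c
  ∑-const c []       = refl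
  ∑-const c (x ∷ xs) = cong (c +_) (∑-const c xs)

  ∑-≤-length* : {f : A → ℕ} (M : ℕ) (xs : List A) → (∀ {x} → x ∈ xs → f x ≤ M) → ∑ xs f ≤ length xs * M
  ∑-≤-length* M []       f≤M = z≤n
  ∑-≤-length* M (x ∷ xs) f≤M = +-mono-≤ (f≤M (here refl)) (∑-≤-length* M xs (f≤M ∘ there))

  ∈⇒≤∑ : (f : A → ℕ) {x : A} {xs : List A} → x ∈ xs → f x ≤ ∑ xs f
  ∈⇒≤∑ f {xs = x ∷ xs} (here refl) = m≤m+n (f x) _
  ∈⇒≤∑ f {xs = x ∷ xs} (there x∈) = ≤-trans (∈⇒≤∑ f x∈) (m≤n+m _ (f x))

  length-filter≡∑𝟙 : {P : A → Set} (P? : Decidable P) (xs : List A) → length (filter P? xs) ≡ ∑[ x ∈ xs ] 𝟙 (P? x)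
  length-filter≡∑𝟙 P? []       = refl
  length-filter≡∑𝟙 P? (x ∷ xs) with P? x
  ... | yes _ = cong suc (length-filter≡∑𝟙 P? xs)
  ... | no _  = length-filter≡∑𝟙 P? xs

module _ {A B : Set} where

  ∑-map : (f : B → ℕ) (g : A → B) (xs : List A) → ∑ (map g xs) f ≡ ∑[ x ∈ xs ] f (g x)
  ∑-map f g []       = refl
  ∑-map f g (x ∷ xs) = cong (f (g x) +_) (∑-map f g xs)

  ∑-concatMap : (f : B → ℕ) (g : A → List B) (xs : List A) → ∑ (concatMap g xs) f ≡ ∑[ x ∈ xs ] ∑ (g x) f
  ∑-concatMap f g []       = refl
  ∑-concatMap f g (x ∷ xs) = trans (∑-++ f (g x) (concatMap g xs)) (cong (∑ (g x) f +_) (∑-concatMap f g xs))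

  ∑-comm : (f : A → B → ℕ) (xs : List A) (ys : List B) →
           ∑[ x ∈ xs ] ∑[ y ∈ ys ] f x y ≡ ∑[ y ∈ ys ] ∑[ x ∈ xs ] f x y
  ∑-comm f []       ys = sym (∑-zero ys)
  ∑-comm f (x ∷ xs) ys = trans (cong (∑ ys (f x) +_) (∑-comm f xs ys))
                               (sym (∑-+ (f x) (λ y → ∑[ x ∈ xs ] f x y) ys))

  length-cartesianProduct : (xs : List A) (ys : List B) → length (cartesianProduct xs ys) ≡ length xs * length ys
  length-cartesianProduct []       ys = refl
  length-cartesianProduct (x ∷ xs) ys =
    trans (List.length-++ (map (x ,_) ys))
          (cong₂ _+_ (List.length-map (x ,_) ys) (length-cartesianProduct xs ys))

-- Counting separated points

count : {P : ℕ → Set} → Decidable P → ℕ → ℕ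
count P? zero    = 0
count P? (suc n) = count P? n + 𝟙 (P? n)

∑-upTo-𝟙 : {P : ℕ → Set} (P? : Decidable P) (n : ℕ) → ∑[ i ∈ upTo n ] 𝟙 (P? i) ≡ count P? n
∑-upTo-𝟙 P? zero    = refl
∑-upTo-𝟙 P? (suc n) = begin
  ∑ (upTo (suc n)) f           ≡⟨ cong (λ is → ∑ is f) (List.upTo-∷ʳ n) ⟨
  ∑ (upTo n ++ [ n ]) f        ≡⟨ ∑-++ f (upTo n) [ n ] ⟩
  ∑ (upTo n) f + (f n + 0)     ≡⟨ cong₂ _+_ (∑-upTo-𝟙 P? n) (+-identityʳ (f n)) ⟩
  count P? n + 𝟙 (P? n)        ∎
  where
  open ≡-Reasoning
  f : ℕ → ℕ
  f i = 𝟙 (P? i)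

module _ {P Q : ℕ → Set} (Q? : Decidable Q) (P? : Decidable P) (Q⇒P : ∀ {i} → Q i → P i) where

  count-mono : ∀ n → count Q? n ≤ count P? n
  count-mono zero    = z≤n
  count-mono (suc n) = +-mono-≤ (count-mono n) (𝟙-mono Q⇒P (Q? n) (P? n))

  count-mono-< : ∀ {j n} → ¬ Q j → P j → j < n → count Q? n < count P? n
  count-mono-< {j} {suc n} ¬Qj Pj j<1+n with m<1+n⇒m<n∨m≡n j<1+n
  ... | inj₁ j<n  = +-mono-≤ (count-mono-< ¬Qj Pj j<n) (𝟙-mono Q⇒P (Q? n) (P? n))
  ... | inj₂ refl = subst (_≤ count P? j + 𝟙 (P? j)) (+-suc (count Q? j) (𝟙 (Q? j)))
                          (+-mono-≤ (count-mono j) (𝟙-mono-< ¬Qj Pj (Q? j) (P? j)))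

Separated : ℕ → (ℕ → Set) → Set
Separated b P = ∀ {i j} → P i → P j → i < j → i + b ≤ j

∣∸⇒+≤ : ∀ {b i j} → i < j → b ∣ j ∸ i → i + b ≤ j
∣∸⇒+≤ {b} {i} {j} i<j b∣j∸i = begin
  i + b        ≤⟨ +-monoʳ-≤ i (∣⇒≤ {{>-nonZero (m<n⇒0<n∸m i<j)}} b∣j∸i) ⟩
  i + (j ∸ i)  ≡⟨ m+[n∸m]≡n (<⇒≤ i<j) ⟩
  j            ∎
  where open ≤-Reasoning

module _ {P : ℕ → Set} (P? : Decidable P) {b : ℕ} (sep : Separated b P) where

  private
    LastPoint : ℕ → Set
    LastPoint n = count P? n ≡ 0 ⊎ ∃ λ e → P e × e < n × count P? n * b ≤ e + b

    count*b≤ : ∀ {n} → LastPoint n → P n → count P? n * b ≤ n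
    count*b≤ (inj₁ c≡0)                   Pn rewrite c≡0 = z≤n
    count*b≤ (inj₂ (e , Pe , e<n , c*b≤)) Pn = ≤-trans c*b≤ (sep Pe Pn e<n)

    lastPoint : ∀ n → LastPoint n
    lastPoint zero = inj₁ refl
    lastPoint (suc n) with P? n | lastPoint n
    ... | no _  | inj₁ c≡0 = inj₁ (trans (+-identityʳ _) c≡0)
    ... | no _  | inj₂ (e , Pe , e<n , c*b≤) =
      inj₂ (e , Pe , m<n⇒m<1+n e<n , subst (λ c → c * b ≤ e + b) (sym (+-identityʳ (count P? n))) c*b≤)
    ... | yes Pn | last = inj₂ (n , Pn , n<1+n n , count+1*b≤)
      where
      open ≤-Reasoning
      count+1*b≤ : (count P? n + 1) * b ≤ n + b
      count+1*b≤ = begin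
        (count P? n + 1) * b  ≡⟨ cong (_* b) (+-comm (count P? n) 1) ⟩
        b + count P? n * b    ≡⟨ +-comm b _ ⟩
        count P? n * b + b    ≤⟨ +-monoˡ-≤ b (count*b≤ last Pn) ⟩
        n + b                 ∎

  count-separated : ∀ n → count P? n * b ≤ pred n + b
  count-separated n with lastPoint n
  ... | inj₁ c≡0 rewrite c≡0 = z≤n
  ... | inj₂ (e , _ , e<n , c*b≤) = ≤-trans c*b≤ (+-monoˡ-≤ b (<⇒≤pred e<n))

NonzeroMultiple : ℕ → ℤ → Set
NonzeroMultiple b s = b ∣ ℤ.∣ s ∣ × ℤ.∣ s ∣ ≢ 0

nonzeroMultiple? : (b : ℕ) → Decidable (NonzeroMultiple b)
nonzeroMultiple? b s = (b ∣? ℤ.∣ s ∣) ×-dec ¬? (ℤ.∣ s ∣ ≟ 0)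

[j-h]-[i-h]≡j∸i : ∀ h {i j} → i ≤ j → (ℤ.+ j ℤ.- ℤ.+ h) ℤ.- (ℤ.+ i ℤ.- ℤ.+ h) ≡ ℤ.+ (j ∸ i)
[j-h]-[i-h]≡j∸i h {i} {j} i≤j = begin
  (ℤ.+ j ℤ.- ℤ.+ h) ℤ.- (ℤ.+ i ℤ.- ℤ.+ h) ≡⟨ solve 3 (λ J I K → (J :- K) :- (I :- K) := J :- I) refl (ℤ.+ j) (ℤ.+ i) (ℤ.+ h) ⟩
  ℤ.+ j ℤ.- ℤ.+ i                         ≡⟨ ℤ.m-n≡m⊖n j i ⟩
  j ℤ.⊖ i                                 ≡⟨ ℤ.⊖-≥ i≤j ⟩
  ℤ.+ (j ∸ i)                             ∎
  where open ≡-Reasoning; open ℤ-Solver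

-- The multiples of b among the 2H+1 points of [-H, H] are b apart, and 0 is one of them.
nonzeroMultiples-count : (b H : ℕ) → ∑ (rangeSym H) (λ s → 𝟙 (nonzeroMultiple? b s)) * b ≤ 2 * H
nonzeroMultiples-count b H = +-cancelʳ-≤ b _ _ (begin
  ∑ (rangeSym H) g * b + b ≡⟨ cong (λ c → c * b + b) (trans (∑-map g z (upTo N)) (∑-upTo-𝟙 Q? N)) ⟩
  count Q? N * b + b       ≡⟨ +-comm (count Q? N * b) b ⟩
  suc (count Q? N) * b     ≤⟨ *-monoˡ-≤ b (count-mono-< Q? P? (λ (b∣ , _) → b∣) ¬QH PH H<N) ⟩
  count P? N * b           ≤⟨ count-separated P? sep N ⟩
  2 * H + b                ∎)
  where
  open ≤-Reasoning
  N : ℕ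
  N = suc (2 * H)
  g : ℤ → ℕ
  g s = 𝟙 (nonzeroMultiple? b s)
  z : ℕ → ℤ
  z i = ℤ.+ i ℤ.- ℤ.+ H
  P Q : ℕ → Set
  P i = b ∣ ℤ.∣ z i ∣
  Q i = NonzeroMultiple b (z i)
  P? : Decidable P
  P? i = b ∣? ℤ.∣ z i ∣
  Q? : Decidable Q
  Q? i = nonzeroMultiple? b (z i)
  z[H]≡0 : ℤ.∣ z H ∣ ≡ 0
  z[H]≡0 = cong ℤ.∣_∣ (ℤ.+-inverseʳ (ℤ.+ H))
  PH : P H
  PH = subst (b ∣_) (sym z[H]≡0) (b ∣0)
  ¬QH : ¬ Q H
  ¬QH (_ , z[H]≢0) = z[H]≢0 z[H]≡0
  H<N : H < N
  H<N = s≤s (m≤m+n H (H + 0))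
  sep : Separated b P
  sep {i} {j} b∣zi b∣zj i<j = ∣∸⇒+≤ i<j (ℤ.∣⇒∣ᵤ (subst (ℤ.+ b ℤ.∣_) ([j-h]-[i-h]≡j∸i H (<⇒≤ i<j))
    (ℤ.∣m∣n⇒∣m-n (ℤ.∣ᵤ⇒∣ {i = z j} b∣zj) (ℤ.∣ᵤ⇒∣ {i = z i} b∣zi))))

-- Divisors, factorisations and rad

*≡≢0⇒≢0ˡ : ∀ {m n o} → m * n ≡ o → o ≢ 0 → m ≢ 0
*≡≢0⇒≢0ˡ {m} {n} m*n≡o o≢0 refl = o≢0 (sym m*n≡o)

*≡≢0⇒≢0ʳ : ∀ {m n o} → m * n ≡ o → o ≢ 0 → n ≢ 0
*≡≢0⇒≢0ʳ {m} {n} m*n≡o = *≡≢0⇒≢0ˡ (trans (*-comm n m) m*n≡o)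

-- Take c = gcd y m; then y / c is coprime to m / c and divides (m / c) * n.
∣*⇒split : ∀ {y m n} → y ≢ 0 → y ∣ m * n → ∃₂ λ c d → c ∣ m × d ∣ n × c * d ≡ y
∣*⇒split {y} {m} {n} y≢0 y∣m*n = g , y / g , gcd[m,n]∣n y m , y/g∣n , trans (*-comm g (y / g)) y/g*g≡y
  where
  g : ℕ
  g = gcd y m
  instance
    g≢0 : NonZero g
    g≢0 = ≢-nonZero (gcd[m,n]≢0 y m (inj₁ y≢0))
  y/g*g≡y : y / g * g ≡ y
  y/g*g≡y = m/n*n≡m (gcd[m,n]∣m y m)
  m*n≡ : m * n ≡ m / g * n * g
  m*n≡ = begin
    m * n              ≡⟨ cong (_* n) (m/n*n≡m (gcd[m,n]∣n y m)) ⟨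
    m / g * g * n      ≡⟨ solve 3 (λ a b c → a :* b :* c := a :* c :* b) refl (m / g) g n ⟩
    m / g * n * g      ∎
    where open ≡-Reasoning; open +-*-Solver
  y/g∣n : y / g ∣ n
  y/g∣n = coprime-divisor (coprime-/gcd y m) (*-cancelʳ-∣ g (subst₂ _∣_ (sym y/g*g≡y) m*n≡ y∣m*n))

∣prodℕ⇒split : ∀ {k A} (m : Vec ℕ k) → A ≢ 0 → A ∣ prodℕ m → ∃ λ (a : Vec ℕ k) → Pointwise _∣_ a m × prodℕ a ≡ A
∣prodℕ⇒split []       _   A∣1 = [] , [] , sym (∣1⇒≡1 A∣1)
∣prodℕ⇒split (m ∷ ms) A≢0 A∣m*M with ∣*⇒split A≢0 A∣m*M
... | c , d , c∣m , d∣M , c*d≡A with ∣prodℕ⇒split ms (*≡≢0⇒≢0ʳ {c} c*d≡A A≢0) d∣M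
... | a , a∣ms , prod[a]≡d = c ∷ a , c∣m ∷ a∣ms , trans (cong (c *_) prod[a]≡d) c*d≡A

All-∣prodℕ : ∀ {k} (v : Vec ℕ k) → All (_∣ prodℕ v) v
All-∣prodℕ []       = []
All-∣prodℕ (v ∷ vs) = m∣m*n (prodℕ vs) ∷ All.map (λ d∣ → ∣-trans d∣ (n∣m*n v)) (All-∣prodℕ vs)

lcmVec-least : ∀ {k m} {a : Vec ℕ k} → All (_∣ m) a → lcmVec a ∣ m
lcmVec-least []            = 1∣ _
lcmVec-least (a∣m ∷ as∣m) = lcm-least a∣m (lcmVec-least as∣m)

lcmVec≢0 : ∀ {k} (a : Vec ℕ k) → prodℕ a ≢ 0 → lcmVec a ≢ 0
lcmVec≢0 a prod≢0 lcm≡0 = prod≢0 (0∣⇒≡0 (subst (_∣ prodℕ a) lcm≡0 (lcmVec-least (All-∣prodℕ a))))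

lcmVec-*-head : ∀ {k} (a₀ B : ℕ) (as : Vec ℕ k) → lcmVec (a₀ * B ∷ as) ∣ lcmVec (a₀ ∷ as) * B
lcmVec-*-head a₀ B as = lcm-least (*-monoˡ-∣ B (m∣lcm[m,n] a₀ (lcmVec as)))
                                  (∣-trans (n∣lcm[m,n] a₀ (lcmVec as)) (m∣m*n B))

lcmVec∣[j-h]-[i-h]≡j∸i : ∀ {k x z} {a t : Vec ℕ k} → x ≤ z →
  Pointwise _∣_ a (Vec.map (x +_) t) → Pointwise _∣_ a (Vec.map (z +_) t) → lcmVec a ∣ z ∸ x
lcmVec∣[j-h]-[i-h]≡j∸i {t = []}    x≤z []               []               = 1∣ _
lcmVec∣[j-h]-[i-h]≡j∸i {x = x} {z} {a ∷ _} {t ∷ _} x≤z (a∣x+t ∷ as∣x+ts) (a∣z+t ∷ as∣z+ts) =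
  lcm-least (∣m+n∣m⇒∣n (subst (a ∣_) z+t≡ a∣z+t) a∣x+t) (lcmVec∣[j-h]-[i-h]≡j∸i x≤z as∣x+ts as∣z+ts)
  where
  z+t≡ : z + t ≡ x + t + (z ∸ x)
  z+t≡ = begin
    z + t               ≡⟨ cong (_+ t) (m+[n∸m]≡n x≤z) ⟨
    x + (z ∸ x) + t     ≡⟨ solve 3 (λ a b c → a :+ b :+ c := a :+ c :+ b) refl x (z ∸ x) t ⟩
    x + t + (z ∸ x)     ∎
    where open ≡-Reasoning; open +-*-Solver

∈-allVecs : ∀ {A : Set} {k} {xs : List A} {v : Vec A k} → All (_∈ xs) v → v ∈ allVecs k xs
∈-allVecs []                        = here refl
∈-allVecs {k = suc k} {xs} (v∈ ∷ vs∈) =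
  ∈-concatMap⁺ (λ a → map (a ∷_) (allVecs k xs)) (Any.map (λ { refl → ∈-map⁺ _ (∈-allVecs vs∈) }) v∈)

∣⇒∈range1 : ∀ {d y} → y ≢ 0 → d ∣ y → d ∈ range1 y
∣⇒∈range1 {zero}  y≢0 0∣y = ⊥-elim (y≢0 (0∣⇒≡0 0∣y))
∣⇒∈range1 {suc d} y≢0 d∣y = ∈-map⁺ suc (∈-upTo⁺ (∣⇒≤ {{≢-nonZero y≢0}} d∣y))

∈-factorizations : ∀ {k y} (v : Vec ℕ k) → y ≢ 0 → prodℕ v ≡ y → v ∈ factorizations k y
∈-factorizations v y≢0 prod≡y = ∈-filter⁺ (λ v → prodℕ v ≟ _)
  (∈-allVecs (All.map (λ d∣ → ∣⇒∈range1 y≢0 (subst (_ ∣_) prod≡y d∣)) (All-∣prodℕ v))) prod≡y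

foldr-⊓≤ : ∀ {A : Set} (f : A → ℕ) (n : ℕ) {x} {xs} → x ∈ xs → List.foldr (λ v m → f v ⊓ m) n xs ≤ f x
foldr-⊓≤ f n {xs = x ∷ xs} (here refl) = m⊓n≤m (f x) _
foldr-⊓≤ f n {xs = x ∷ xs} (there x∈)  = ≤-trans (m⊓n≤n (f x) _) (foldr-⊓≤ f n x∈)

rad≤lcmVec : ∀ {k y} {v : Vec ℕ k} → v ∈ factorizations k y → rad k y ≤ lcmVec v
rad≤lcmVec {y = y} = foldr-⊓≤ lcmVec y

length-allVecs : ∀ {A : Set} k (xs : List A) → length (allVecs k xs) ≡ length xs ^ k
length-allVecs zero    xs = refl
length-allVecs (suc k) xs = begin
  length (concatMap extend xs)                 ≡⟨ length≡∑1 (concatMap extend xs) ⟩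
  ∑ (concatMap extend xs) (λ _ → 1)            ≡⟨ ∑-concatMap (λ _ → 1) extend xs ⟩
  ∑[ a ∈ xs ] ∑ (map (a ∷_) vs) (λ _ → 1)      ≡⟨ ∑-cong xs (λ a → ∑-map (λ _ → 1) (a ∷_) vs) ⟩
  ∑[ a ∈ xs ] ∑ vs (λ _ → 1)                   ≡⟨ ∑-cong xs (λ _ → trans (sym (length≡∑1 vs)) (length-allVecs k xs)) ⟩
  ∑[ a ∈ xs ] length xs ^ k                    ≡⟨ ∑-const (length xs ^ k) xs ⟩
  length xs * length xs ^ k                    ∎
  where
  open ≡-Reasoning
  vs = allVecs k xs
  extend : _ → List (Vec _ (suc k))
  extend a = map (a ∷_) vs

-- The fibre over a splitting y = ∏a ∏b

∑-allVecs-zipWith : ∀ {A B : Set} {k} (f : B → A → ℕ) (bs : Vec B k) (xs : List A) →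
  ∑ (allVecs k xs) (λ v → prodℕ (Vec.zipWith f bs v)) ≡ prodℕ (Vec.map (λ b → ∑ xs (f b)) bs)
∑-allVecs-zipWith f []       xs = refl
∑-allVecs-zipWith {k = suc k} f (b ∷ bs) xs = begin
  ∑ (concatMap extend xs) (w (b ∷ bs))              ≡⟨ ∑-concatMap (w (b ∷ bs)) extend xs ⟩
  ∑[ a ∈ xs ] ∑ (map (a ∷_) vs) (w (b ∷ bs))        ≡⟨ ∑-cong xs (λ a → ∑-map (w (b ∷ bs)) (a ∷_) vs) ⟩
  ∑[ a ∈ xs ] ∑[ v ∈ vs ] f b a * w bs v            ≡⟨ ∑-cong xs (λ a → ∑-*ˡ (f b a) (w bs) vs) ⟩
  ∑[ a ∈ xs ] f b a * ∑ vs (w bs)                   ≡⟨ ∑-cong xs (λ a → cong (f b a *_) (∑-allVecs-zipWith f bs xs)) ⟩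
  ∑[ a ∈ xs ] f b a * prodℕ (Vec.map sums bs)       ≡⟨ ∑-*ʳ (prodℕ (Vec.map sums bs)) (f b) xs ⟩
  sums b * prodℕ (Vec.map sums bs)                  ∎
  where
  open ≡-Reasoning
  vs = allVecs k xs
  extend : _ → List (Vec _ (suc k))
  extend a = map (a ∷_) vs
  w : ∀ {n} → Vec _ n → Vec _ n → ℕ
  w bs v = prodℕ (Vec.zipWith f bs v)
  sums : _ → ℕ
  sums b = ∑ xs (f b)

prodℕ-map*prodℕ≤^ : ∀ {k M} (f : ℕ → ℕ) (bs : Vec ℕ k) → (∀ b → f b * b ≤ M) →
  prodℕ (Vec.map f bs) * prodℕ bs ≤ M ^ k
prodℕ-map*prodℕ≤^         f []       fb*b≤M = ≤-refl
prodℕ-map*prodℕ≤^ {suc k} {M} f (b ∷ bs) fb*b≤M = begin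
  f b * F * (b * B)  ≡⟨ solve 4 (λ x F b B → x :* F :* (b :* B) := x :* b :* (F :* B)) refl (f b) F b B ⟩
  f b * b * (F * B)  ≤⟨ *-mono-≤ (fb*b≤M b) (prodℕ-map*prodℕ≤^ f bs fb*b≤M) ⟩
  M * M ^ k          ∎
  where
  open ≤-Reasoning; open +-*-Solver
  F = prodℕ (Vec.map f bs)
  B = prodℕ bs

hWeight : ∀ {k} → Vec ℕ k → Vec ℤ k → ℕ
hWeight b h = prodℕ (Vec.zipWith (λ bᵢ hᵢ → 𝟙 (nonzeroMultiple? bᵢ hᵢ)) b h)

∑-hWeight*prodℕ≤ : ∀ {k} (H : ℕ) (b : Vec ℕ k) → ∑ (allVecs k (rangeSym H)) (hWeight b) * prodℕ b ≤ (2 * H) ^ k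
∑-hWeight*prodℕ≤ {k} H b =
  subst (λ s → s * prodℕ b ≤ (2 * H) ^ k)
        (sym (∑-allVecs-zipWith (λ bᵢ hᵢ → 𝟙 (nonzeroMultiple? bᵢ hᵢ)) b (rangeSym H)))
        (prodℕ-map*prodℕ≤^ _ b (λ bᵢ → nonzeroMultiples-count bᵢ H))

∣prodℤ∣ : ∀ {k} (h : Vec ℤ k) → ℤ.∣ prodℤ h ∣ ≡ prodℕ (Vec.map ℤ.∣_∣ h)
∣prodℤ∣ []       = refl
∣prodℤ∣ (h ∷ hs) = trans (ℤ.abs-* h (prodℤ hs)) (cong (ℤ.∣ h ∣ *_) (∣prodℤ∣ hs))

hWeight≡1 : ∀ {k} (b : Vec ℕ k) (h : Vec ℤ k) → Pointwise _∣_ b (Vec.map ℤ.∣_∣ h) →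
  prodℕ (Vec.map ℤ.∣_∣ h) ≢ 0 → hWeight b h ≡ 1
hWeight≡1 []       []       []               _       = refl
hWeight≡1 (b ∷ bs) (h ∷ hs) (b∣h ∷ bs∣hs) prod≢0 = cong₂ _*_
  (𝟙-yes (nonzeroMultiple? b h) (b∣h , *≡≢0⇒≢0ˡ refl prod≢0))
  (hWeight≡1 bs hs bs∣hs (*≡≢0⇒≢0ʳ {ℤ.∣ h ∣} refl prod≢0))

shifts? : ∀ {k} (a : Vec ℕ k) (x : ℕ) (t : Vec ℕ k) → Dec (Pointwise _∣_ a (Vec.map (x +_) t))
shifts? a x t = Pointwise.decidable _∣?_ a (Vec.map (x +_) t)

shifts-count : ∀ {k} (X : ℕ) (a t : Vec ℕ k) → ∑ (range1 X) (λ x → 𝟙 (shifts? a x t)) * lcmVec a ≤ X + lcmVec a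
shifts-count X a t = begin
  ∑ (range1 X) (λ x → 𝟙 (shifts? a x t)) * lcmVec a  ≡⟨ cong (_* lcmVec a) (trans (∑-map _ suc (upTo X)) (∑-upTo-𝟙 P? X)) ⟩
  count P? X * lcmVec a                              ≤⟨ count-separated P? sep X ⟩
  pred X + lcmVec a                                  ≤⟨ +-monoˡ-≤ (lcmVec a) pred[n]≤n ⟩
  X + lcmVec a                                       ∎
  where
  open ≤-Reasoning
  P : ℕ → Set
  P i = Pointwise _∣_ a (Vec.map (suc i +_) t)
  P? : Decidable P
  P? i = shifts? a (suc i) t
  sep : Separated (lcmVec a) P
  sep i∣ j∣ i<j = ∣∸⇒+≤ i<j (lcmVec∣[j-h]-[i-h]≡j∸i (s≤s (<⇒≤ i<j)) i∣ j∣)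

∑-allTuples : ∀ {k} (X H : ℕ) (w : Tuple k → ℕ) (f : ℕ → Vec ℕ k → ℕ) (g : Vec ℤ k → ℕ) →
  (∀ x t h → w (x , t , h) ≡ f x t * g h) →
  ∑ (allTuples k X H) w ≡ ∑[ t ∈ allVecs k (range1 H) ] ∑ (range1 X) (λ x → f x t) * ∑ (allVecs k (rangeSym H)) g
∑-allTuples {k} X H w f g w≡f*g = begin
  ∑ (concatMap (λ x → concatMap (λ t → map (λ h → x , t , h) hs) ts) xs) w
    ≡⟨ ∑-concatMap w _ xs ⟩
  ∑[ x ∈ xs ] ∑ (concatMap (λ t → map (λ h → x , t , h) hs) ts) w
    ≡⟨ ∑-cong xs (λ x → ∑-concatMap w _ ts) ⟩
  ∑[ x ∈ xs ] ∑[ t ∈ ts ] ∑ (map (λ h → x , t , h) hs) w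
    ≡⟨ ∑-cong xs (λ x → ∑-cong ts (λ t → trans (∑-map w (λ h → x , t , h) hs) (∑-cong hs (w≡f*g x t)))) ⟩
  ∑[ x ∈ xs ] ∑[ t ∈ ts ] ∑[ h ∈ hs ] f x t * g h
    ≡⟨ ∑-cong xs (λ x → ∑-cong ts (λ t → ∑-*ˡ (f x t) g hs)) ⟩
  ∑[ x ∈ xs ] ∑[ t ∈ ts ] f x t * ∑ hs g
    ≡⟨ ∑-comm (λ x t → f x t * ∑ hs g) xs ts ⟩
  ∑[ t ∈ ts ] ∑[ x ∈ xs ] f x t * ∑ hs g
    ≡⟨ ∑-cong ts (λ t → ∑-*ʳ (∑ hs g) (λ x → f x t) xs) ⟩
  ∑[ t ∈ ts ] ∑ xs (λ x → f x t) * ∑ hs g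
    ∎
  where
  open ≡-Reasoning
  xs = range1 X
  ts = allVecs k (range1 H)
  hs = allVecs k (rangeSym H)

-- (c - 1) L ≤ X and r ≤ L B give c r ≤ r + X B; the weight S then absorbs B.
count*weight*rad≤ : ∀ {c L X r B S M} → c * L ≤ X + L → r ≤ L * B → S * B ≤ M → S ≤ M →
  c * S * r ≤ M * (r + X)
count*weight*rad≤ {c} {L} {X} {r} {B} {S} {M} c*L≤X+L r≤L*B S*B≤M S≤M = begin
  c * S * r          ≡⟨ solve 3 (λ c S r → c :* S :* r := S :* (c :* r)) refl c S r ⟩
  S * (c * r)        ≤⟨ *-monoʳ-≤ S (c*r≤ c c*L≤X+L) ⟩
  S * (r + X * B)    ≡⟨ solve 4 (λ S r X B → S :* (r :+ X :* B) := S :* r :+ S :* B :* X) refl S r X B ⟩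
  S * r + S * B * X  ≤⟨ +-mono-≤ (*-monoˡ-≤ r S≤M) (*-monoˡ-≤ X S*B≤M) ⟩
  M * r + M * X      ≡⟨ *-distribˡ-+ M r X ⟨
  M * (r + X)        ∎
  where
  open ≤-Reasoning; open +-*-Solver
  c*r≤ : ∀ c → c * L ≤ X + L → c * r ≤ r + X * B
  c*r≤ zero    _         = z≤n
  c*r≤ (suc c) c*L+L≤X+L = +-monoʳ-≤ r (begin
    c * r        ≤⟨ *-monoʳ-≤ c r≤L*B ⟩
    c * (L * B)  ≡⟨ *-assoc c L B ⟨
    c * L * B    ≤⟨ *-monoˡ-≤ B (+-cancelʳ-≤ L (c * L) X (subst (_≤ X + L) (+-comm L (c * L)) c*L+L≤X+L)) ⟩
    X * B        ∎)

Splits : ∀ {k} → ℕ → Vec ℕ k × Vec ℕ k → Set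
Splits y (a , b) = prodℕ a * prodℕ b ≡ y

splits? : ∀ {k} (y : ℕ) → Decidable (Splits {k} y)
splits? y (a , b) = prodℕ a * prodℕ b ≟ y

fits : ∀ {k} → Vec ℕ k × Vec ℕ k → Tuple k → ℕ
fits (a , b) (x , t , h) = 𝟙 (shifts? a x t) * hWeight b h

-- The head entry absorbs B, turning (a, b) into a k-fold factorisation of y with lcm at most lcm(a) B.
fibre-bound : ∀ {k} (y X H : ℕ) (a b : Vec ℕ (suc k)) → Splits y (a , b) → y ≢ 0 →
  ∑ (allTuples (suc k) X H) (fits (a , b)) * rad (suc k) y ≤ H ^ suc k * ((2 * H) ^ suc k * (rad (suc k) y + X))
fibre-bound {k} y X H a@(a₀ ∷ as) b A*B≡y y≢0 = begin
  ∑ (allTuples K X H) (fits (a , b)) * r        ≡⟨ cong (_* r) (∑-allTuples X H (fits (a , b)) _ (hWeight b) (λ _ _ _ → refl)) ⟩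
  (∑[ t ∈ ts ] xCount t * S) * r                ≡⟨ ∑-*ʳ r (λ t → xCount t * S) ts ⟨
  ∑[ t ∈ ts ] xCount t * S * r                  ≤⟨ ∑-≤-length* M ts (λ {t} _ → count*weight*rad≤ {xCount t} (shifts-count X a t) r≤L*B S*B≤M S≤M) ⟩
  length ts * M                                 ≡⟨ cong (_* M) (trans (length-allVecs K (range1 H)) (cong (_^ K) (trans (List.length-map suc (upTo H)) (List.length-upTo H)))) ⟩
  H ^ K * M                                     ∎
  where
  open ≤-Reasoning
  K = suc k
  r = rad K y
  B = prodℕ b
  M = (2 * H) ^ K * (r + X)
  ts = allVecs K (range1 H)
  xCount : Vec ℕ K → ℕ
  xCount t = ∑ (range1 X) (λ x → 𝟙 (shifts? a x t))
  S = ∑ (allVecs K (rangeSym H)) (hWeight b)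
  B≢0 : B ≢ 0
  B≢0 = *≡≢0⇒≢0ʳ {prodℕ a} A*B≡y y≢0
  S*B≤M : S * B ≤ (2 * H) ^ K
  S*B≤M = ∑-hWeight*prodℕ≤ H b
  S≤M : S ≤ (2 * H) ^ K
  S≤M = ≤-trans (m≤m*n S B {{≢-nonZero B≢0}}) S*B≤M
  r≤L*B : r ≤ lcmVec a * B
  r≤L*B = begin
    r                       ≤⟨ rad≤lcmVec {y = y} (∈-factorizations (a₀ * B ∷ as) y≢0 prod≡y) ⟩
    lcmVec (a₀ * B ∷ as)    ≤⟨ ∣⇒≤ {{m*n≢0 _ _ {{≢-nonZero (lcmVec≢0 a (*≡≢0⇒≢0ˡ A*B≡y y≢0))}} {{≢-nonZero B≢0}}}} (lcmVec-*-head a₀ B as) ⟩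
    lcmVec a * B            ∎
    where
    prod≡y : a₀ * B * prodℕ as ≡ y
    prod≡y = trans (solve 3 (λ a₀ B P → a₀ :* B :* P := a₀ :* P :* B) refl a₀ B (prodℕ as)) A*B≡y
      where open +-*-Solver

-- Covering B_k(X,H;y) by fibres

-- m ÷ 0 = 0 is a junk value, never used on a genuine splitting.
infixl 7 _÷_
_÷_ : ℕ → ℕ → ℕ
m ÷ zero  = 0
m ÷ suc n = m / suc n

m*n÷n≡m : ∀ m {n} → n ≢ 0 → m * n ÷ n ≡ m
m*n÷n≡m m {zero}  n≢0 = ⊥-elim (n≢0 refl)
m*n÷n≡m m {suc n} _   = m*n/n≡m m (suc n)

-- (a, b) with ∏a ∏b = y is recovered from the factorisations y = A B, (a₀ B, a₁, …, aₖ) and (b₀ A, b₁, …, bₖ).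
unsplit : ∀ {k} → Vec ℕ 2 × Vec ℕ (suc k) × Vec ℕ (suc k) → Vec ℕ (suc k) × Vec ℕ (suc k)
unsplit ((A ∷ B ∷ []) , (u₀ ∷ us) , (v₀ ∷ vs)) = (u₀ ÷ B ∷ us) , (v₀ ÷ A ∷ vs)

triples : (k y : ℕ) → List (Vec ℕ 2 × Vec ℕ (suc k) × Vec ℕ (suc k))
triples k y = cartesianProduct (factorizations 2 y) (cartesianProduct (factorizations (suc k) y) (factorizations (suc k) y))

splittings : (k y : ℕ) → List (Vec ℕ (suc k) × Vec ℕ (suc k))
splittings k y = filter (splits? y) (map unsplit (triples k y))

length-splittings≤ : ∀ k y → length (splittings k y) ≤ τ 2 y * (τ (suc k) y * τ (suc k) y)
length-splittings≤ k y = begin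
  length (splittings k y)                 ≤⟨ List.length-filter (splits? y) (map unsplit (triples k y)) ⟩
  length (map unsplit (triples k y))      ≡⟨ List.length-map unsplit (triples k y) ⟩
  length (triples k y)                    ≡⟨ length-cartesianProduct F₂ (cartesianProduct Fₖ Fₖ) ⟩
  τ 2 y * length (cartesianProduct Fₖ Fₖ) ≡⟨ cong (τ 2 y *_) (length-cartesianProduct Fₖ Fₖ) ⟩
  τ 2 y * (τ (suc k) y * τ (suc k) y)     ∎
  where
  open ≤-Reasoning
  F₂ = factorizations 2 y
  Fₖ = factorizations (suc k) y

∈-splittings : ∀ {k y} (a b : Vec ℕ (suc k)) → y ≢ 0 → Splits y (a , b) → (a , b) ∈ splittings k y
∈-splittings {k} {y} a@(a₀ ∷ as) b@(b₀ ∷ bs) y≢0 A*B≡y =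
  ∈-filter⁺ (splits? y) (subst (_∈ map unsplit (triples k y)) unsplit≡ (∈-map⁺ unsplit triple∈)) A*B≡y
  where
  open +-*-Solver
  A = prodℕ a
  B = prodℕ b
  unsplit≡ : unsplit ((A ∷ B ∷ []) , (a₀ * B ∷ as) , (b₀ * A ∷ bs)) ≡ (a , b)
  unsplit≡ = cong₂ (λ a₀ b₀ → (a₀ ∷ as) , (b₀ ∷ bs)) (m*n÷n≡m a₀ {B} (*≡≢0⇒≢0ʳ {A} A*B≡y y≢0))
                                                     (m*n÷n≡m b₀ {A} (*≡≢0⇒≢0ˡ {A} A*B≡y y≢0))
  a₀B*as≡y : a₀ * B * prodℕ as ≡ y
  a₀B*as≡y = trans (solve 3 (λ a₀ B P → a₀ :* B :* P := a₀ :* P :* B) refl a₀ B (prodℕ as)) A*B≡y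
  b₀A*bs≡y : b₀ * A * prodℕ bs ≡ y
  b₀A*bs≡y = trans (solve 3 (λ b₀ A P → b₀ :* A :* P := A :* (b₀ :* P)) refl b₀ A (prodℕ bs)) A*B≡y
  triple∈ : ((A ∷ B ∷ []) , (a₀ * B ∷ as) , (b₀ * A ∷ bs)) ∈ triples k y
  triple∈ = ∈-cartesianProduct⁺ (∈-factorizations (A ∷ B ∷ []) y≢0 (trans (cong (A *_) (*-identityʳ B)) A*B≡y))
              (∈-cartesianProduct⁺ (∈-factorizations (a₀ * B ∷ as) y≢0 a₀B*as≡y)
                                   (∈-factorizations (b₀ * A ∷ bs) y≢0 b₀A*bs≡y))

∈-splittings⁻ : ∀ {k y ab} → ab ∈ splittings k y → Splits y ab
∈-splittings⁻ {k} {y} ab∈ = proj₂ (∈-filter⁻ (splits? y) {xs = map unsplit (triples k y)} ab∈)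

InB⇒∣ : ∀ {k y x t h} → InB k y (x , t , h) →
  y ∣ prodℕ (Vec.map (x +_) t) * prodℕ (Vec.map ℤ.∣_∣ h) × prodℕ (Vec.map ℤ.∣_∣ h) ≢ 0
InB⇒∣ {x = x} {t} {h} (y∣ , prod≢0) =
  subst (_ ∣_) (trans (ℤ.abs-* (ℤ.+ P) (prodℤ h)) (cong (P *_) (∣prodℤ∣ h))) y∣ ,
  λ Q≡0 → prod≢0 (ℤ.∣i∣≡0⇒i≡0 (trans (∣prodℤ∣ h) Q≡0))
  where
  P = prodℕ (Vec.map (x +_) t)

InB⇒fits : ∀ {k y x t h} → y ≢ 0 → InB k y (x , t , h) → ∃ λ ab → Splits y ab × fits ab (x , t , h) ≡ 1
InB⇒fits {k} {y} {x} {t} {h} y≢0 inB with InB⇒∣ {k} {y} {x} {t} {h} inB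
... | y∣P*Q , Q≢0 with ∣*⇒split y≢0 y∣P*Q
... | A , B , A∣P , B∣Q , A*B≡y
    with ∣prodℕ⇒split (Vec.map (x +_) t) (*≡≢0⇒≢0ˡ A*B≡y y≢0) A∣P
       | ∣prodℕ⇒split (Vec.map ℤ.∣_∣ h) (*≡≢0⇒≢0ʳ {A} A*B≡y y≢0) B∣Q
... | a , a∣x+t , prod[a]≡A | b , b∣h , prod[b]≡B =
  (a , b) , trans (cong₂ _*_ prod[a]≡A prod[b]≡B) A*B≡y ,
  cong₂ _*_ (𝟙-yes (shifts? a x t) a∣x+t) (hWeight≡1 b h b∣h Q≢0)

cardB≤∑fibres : ∀ k y X H → y ≢ 0 →
  cardB (suc k) X H y ≤ ∑[ ab ∈ splittings k y ] ∑ (allTuples (suc k) X H) (fits ab)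
cardB≤∑fibres k y X H y≢0 = begin
  cardB (suc k) X H y                          ≡⟨ length-filter≡∑𝟙 (InB? (suc k) y) T ⟩
  ∑[ p ∈ T ] 𝟙 (InB? (suc k) y p)              ≤⟨ ∑-mono-≤ T 𝟙≤∑fits ⟩
  ∑[ p ∈ T ] ∑[ ab ∈ splittings k y ] fits ab p ≡⟨ ∑-comm (λ p ab → fits ab p) T (splittings k y) ⟩
  ∑[ ab ∈ splittings k y ] ∑ T (fits ab)       ∎
  where
  open ≤-Reasoning
  T = allTuples (suc k) X H
  𝟙≤∑fits : ∀ p → 𝟙 (InB? (suc k) y p) ≤ ∑[ ab ∈ splittings k y ] fits ab p
  𝟙≤∑fits p@(x , t , h) = 𝟙≤ (InB? (suc k) y p) λ inB →
    let (a , b) , splits , fits≡1 = InB⇒fits {suc k} {y} {x} {t} {h} y≢0 inB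
    in ≤-trans (≤-reflexive (sym fits≡1)) (∈⇒≤∑ (λ ab → fits ab p) (∈-splittings a b y≢0 splits))

cardB*rad≤ : ∀ k y X H → y ≢ 0 → cardB (suc k) X H y * rad (suc k) y ≤
  τ 2 y * (τ (suc k) y * τ (suc k) y) * (H ^ suc k * ((2 * H) ^ suc k * (rad (suc k) y + X)))
cardB*rad≤ k y X H y≢0 = begin
  cardB (suc k) X H y * r                   ≤⟨ *-monoˡ-≤ r (cardB≤∑fibres k y X H y≢0) ⟩
  (∑[ ab ∈ S ] fibre ab) * r                ≡⟨ ∑-*ʳ r fibre S ⟨
  ∑[ ab ∈ S ] fibre ab * r                  ≤⟨ ∑-≤-length* Bd S (λ {(a , b)} ab∈ →
                                                 fibre-bound y X H a b (∈-splittings⁻ ab∈) y≢0) ⟩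
  length S * Bd                             ≤⟨ *-monoˡ-≤ Bd (length-splittings≤ k y) ⟩
  τ 2 y * (τ (suc k) y * τ (suc k) y) * Bd  ∎
  where
  open ≤-Reasoning
  r = rad (suc k) y
  S = splittings k y
  Bd = H ^ suc k * ((2 * H) ^ suc k * (r + X))
  fibre : Vec ℕ (suc k) × Vec ℕ (suc k) → ℕ
  fibre ab = ∑ (allTuples (suc k) X H) (fits ab)

lemma3p2 : Σ ℕ (λ C → (k y X H : ℕ) → 1 ≤ k → 1 ≤ y → 1 ≤ X → 1 ≤ H →
    cardB k X H y * rad k y ≤ (C * H) ^ (2 * k) * (τ 2 y * (τ k y * τ k y)) * (C * (rad k y + X)))
lemma3p2 = 2 , bound
  where
  bound : (k y X H : ℕ) → 1 ≤ k → 1 ≤ y → 1 ≤ X → 1 ≤ H →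
    cardB k X H y * rad k y ≤ (2 * H) ^ (2 * k) * (τ 2 y * (τ k y * τ k y)) * (2 * (rad k y + X))
  bound (suc k) y X H _ 0<y _ _ = begin
    cardB K X H y * rad K y        ≤⟨ cardB*rad≤ k y X H (n>0⇒n≢0 0<y) ⟩
    T * (H ^ K * (P * Z))          ≤⟨ *-monoʳ-≤ T (*-monoˡ-≤ (P * Z) (^-monoˡ-≤ K (m≤m+n H (H + 0)))) ⟩
    T * (P * (P * Z))              ≡⟨ solve 3 (λ T P Z → T :* (P :* (P :* Z)) := P :* P :* T :* Z) refl T P Z ⟩
    P * P * T * Z                  ≡⟨ cong (λ Q → Q * T * Z) (^-distribˡ-+-* (2 * H) K K) ⟨
    (2 * H) ^ (K + K) * T * Z      ≤⟨ *-monoʳ-≤ ((2 * H) ^ (K + K) * T) (m≤m+n Z (Z + 0)) ⟩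
    (2 * H) ^ (K + K) * T * (2 * Z) ≡⟨ cong (λ n → (2 * H) ^ n * T * (2 * Z)) (cong (K +_) (+-identityʳ K)) ⟨
    (2 * H) ^ (2 * K) * T * (2 * Z) ∎
    where
    open ≤-Reasoning; open +-*-Solver
    K = suc k
    T = τ 2 y * (τ K y * τ K y)
    P = (2 * H) ^ K
    Z = rad K y + X
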